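{- Let $G$ be a graph with vertex set $\{v_1,\dots,v_n\}$ and let $D_G$ be its extended double cover: the bipartite graph with parts $X=\{x_1,\dots,x_n\}$ and $Y=\{y_1,\dots,y_n\}$ in which $x_iy_j\in E(D_G)$ if and only if $j=i$ or $v_iv_j\in E(G)$. Let $k\ge1$. Then (i) $G$ is $k$-CFCN$^*$-choosable if and only if $D_G$ is $k$-CFON$^*$-choosable; and (ii) $G$ is $k$-CFCN-choosable if and only if $D_G$ is $k$-CFON-choosable.
   Context: Graphs are finite, simple, undirected. For a list assignment $\mathcal{L}=\{L_v\}$ of a graph $H$, an $\mathcal{L}$-CFON$^*$-coloring (resp. $\mathcal{L}$-CFCN$^*$-coloring) is a map $f:V'\to\bigcup_{v\in V'}L_v$ on some subset $V'\subseteq V(H)$ with $f(v)\in L_v$ for $v\in V'$, such that every vertex $v$ has a color appearing on exactly one vertex of its open neighborhood $N_H(v)$ (resp. closed neighborhood $N_H[v]=N_H(v)\cup\{v\}$). An $\mathcal{L}$-CFON-coloring (resp. $\mathcal{L}$-CFCN-coloring) is the same but with $V'=V(H)$, i.e. every vertex must be colored. $H$ is $k$-CFON$^*$-choosable (resp. $k$-CFCN$^*$-, $k$-CFON-, $k$-CFCN-choosable) if the corresponding coloring exists for every list assignment with $|L_v|=k$ for all $v$. -}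

module Defs where

open import Data.Nat using (ℕ)
open import Data.Fin using (Fin)
open import Data.Maybe using (Maybe; just)
open import Data.List using (List; length)
open import Data.List.Membership.Propositional using (_∈_)
open import Data.List.Relation.Unary.Unique.Propositional using (Unique)
open import Data.Product using (Σ; _×_; _,_)
open import Data.Sum using (_⊎_; inj₁; inj₂)
open import Data.Empty using (⊥)
open import Relation.Nullary using (¬_)
open import Relation.Binary.PropositionalEquality using (_≡_)

record Graph (V : Set) : Set₁ where
  field
    Adj    : V → V → Set
    sym    : ∀ {u v} → Adj u v → Adj v u
    irrefl : ∀ {v} → ¬ Adj v v
open Graph public

N[_]⟨_⟩ : ∀ {V} → Graph V → V → V → Set
N[ H ]⟨ v ⟩ u = Adj H v u

N[_]⟦_⟧ : ∀ {V} → Graph V → V → V → Set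
N[ H ]⟦ v ⟧ u = (u ≡ v) ⊎ Adj H v u

ListAssignment : ℕ → (V : Set) → Set
ListAssignment k V = Σ (V → List ℕ) λ L → ∀ v → length (L v) ≡ k × Unique (L v)

HasUniqueColour : ∀ {V : Set} → (V → Set) → (V → Maybe ℕ) → Set
HasUniqueColour {V} S f =
  Σ ℕ λ c → Σ V λ u → S u × f u ≡ just c × (∀ w → S w → f w ≡ just c → w ≡ u)

-- partial colourings (f v = nothing means v ∉ V')
RespectsListsPartial : ∀ {k V} → ListAssignment k V → (V → Maybe ℕ) → Set
RespectsListsPartial {V = V} (L , _) f = ∀ (v : V) c → f v ≡ just c → c ∈ L v

RespectsLists : ∀ {k V} → ListAssignment k V → (V → ℕ) → Set
RespectsLists {V = V} (L , _) f = ∀ (v : V) → f v ∈ L v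

IsCFONStarColouring : ∀ {k V} → Graph V → ListAssignment k V → (V → Maybe ℕ) → Set
IsCFONStarColouring H L f = RespectsListsPartial L f × (∀ v → HasUniqueColour N[ H ]⟨ v ⟩ f)

IsCFCNStarColouring : ∀ {k V} → Graph V → ListAssignment k V → (V → Maybe ℕ) → Set
IsCFCNStarColouring H L f = RespectsListsPartial L f × (∀ v → HasUniqueColour N[ H ]⟦ v ⟧ f)

IsCFONColouring : ∀ {k V} → Graph V → ListAssignment k V → (V → ℕ) → Set
IsCFONColouring H L f = RespectsLists L f × (∀ v → HasUniqueColour N[ H ]⟨ v ⟩ (λ u → just (f u)))

IsCFCNColouring : ∀ {k V} → Graph V → ListAssignment k V → (V → ℕ) → Set
IsCFCNColouring H L f = RespectsLists L f × (∀ v → HasUniqueColour N[ H ]⟦ v ⟧ (λ u → just (f u)))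

CFONStarChoosable : ∀ {V} → ℕ → Graph V → Set
CFONStarChoosable {V} k H = ∀ (L : ListAssignment k V) → Σ (V → Maybe ℕ) (IsCFONStarColouring H L)

CFCNStarChoosable : ∀ {V} → ℕ → Graph V → Set
CFCNStarChoosable {V} k H = ∀ (L : ListAssignment k V) → Σ (V → Maybe ℕ) (IsCFCNStarColouring H L)

CFONChoosable : ∀ {V} → ℕ → Graph V → Set
CFONChoosable {V} k H = ∀ (L : ListAssignment k V) → Σ (V → ℕ) (IsCFONColouring H L)

CFCNChoosable : ∀ {V} → ℕ → Graph V → Set
CFCNChoosable {V} k H = ∀ (L : ListAssignment k V) → Σ (V → ℕ) (IsCFCNColouring H L)

-- extended double cover: X = inj₁, Y = inj₂; x_i y_j adjacent iff j = i or v_i v_j ∈ E(G)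
DCAdj : ∀ {n} → Graph (Fin n) → Fin n ⊎ Fin n → Fin n ⊎ Fin n → Set
DCAdj G (inj₁ i) (inj₁ j) = ⊥
DCAdj G (inj₁ i) (inj₂ j) = (j ≡ i) ⊎ Adj G i j
DCAdj G (inj₂ j) (inj₁ i) = (j ≡ i) ⊎ Adj G i j
DCAdj G (inj₂ i) (inj₂ j) = ⊥

DC-sym : ∀ {n} (G : Graph (Fin n)) {u v} → DCAdj G u v → DCAdj G v u
DC-sym G {inj₁ i} {inj₂ j} p = p
DC-sym G {inj₂ j} {inj₁ i} p = p

DC-irrefl : ∀ {n} (G : Graph (Fin n)) {v} → ¬ DCAdj G v v
DC-irrefl G {inj₁ i} ()
DC-irrefl G {inj₂ i} ()

ExtDoubleCover : ∀ {n} → Graph (Fin n) → Graph (Fin n ⊎ Fin n)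
ExtDoubleCover G = record { Adj = DCAdj G ; sym = DC-sym G ; irrefl = DC-irrefl G }

-- In the extended double cover, the open neighbourhood of x_i is {y_j : j ∈ N_G[i]} and
-- that of y_j is {x_i : i ∈ N_G[j]}. So a colouring of D_G is exactly a pair of colourings
-- of G (one read on X, one on Y), and the open-neighbourhood condition at x_i (resp. y_j)
-- for D_G is the closed-neighbourhood condition at i (resp. j) for the colouring on the
-- other side. Given lists on D_G, colour G once with the X-lists and once with the Y-lists;
-- given lists on G, put them on both sides of D_G and read off the colouring on X.
module Submission where

open import Defs
open import Data.Nat using (ℕ; _≥_)
open import Data.Fin using (Fin)
open import Data.Maybe using (Maybe; just)
open import Data.Product using (_×_; _,_)
open import Data.Sum using (_⊎_; inj₁; inj₂; [_,_])
open import Data.Sum.Properties using (inj₁-injective; inj₂-injective)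
open import Function using (_∘_)
open import Function.Bundles using (_⇔_; mk⇔; Equivalence)
import Function.Properties.Equivalence as ⇔
open import Relation.Nullary using (¬_)
open import Relation.Binary.PropositionalEquality using (_≡_; refl; cong)

open Equivalence using (to; from)

module _ {V : Set} where

  HasUniqueColour-resp : {S T : V → Set} (f : V → Maybe ℕ) →
    (∀ v → S v ⇔ T v) → HasUniqueColour S f ⇔ HasUniqueColour T f
  HasUniqueColour-resp f S⇔T = mk⇔ (transfer S⇔T) (transfer (⇔.sym ∘ S⇔T))
    where
    transfer : {S T : V → Set} → (∀ v → S v ⇔ T v) →
      HasUniqueColour S f → HasUniqueColour T f
    transfer S⇔T (c , u , Su , fu , unique) =
      c , u , to (S⇔T u) Su , fu , λ w Tw → unique w (from (S⇔T w) Tw)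

  ∈closedNbhd-sym : (G : Graph V) {u v : V} → N[ G ]⟦ v ⟧ u → N[ G ]⟦ u ⟧ v
  ∈closedNbhd-sym G (inj₁ refl) = inj₁ refl
  ∈closedNbhd-sym G (inj₂ a)    = inj₂ (Graph.sym G a)

module _ {A B : Set} where

  HasUniqueColour-⊎ˡ : {S : A ⊎ B → Set} (f : A ⊎ B → Maybe ℕ) → (∀ b → ¬ S (inj₂ b)) →
    HasUniqueColour S f ⇔ HasUniqueColour (S ∘ inj₁) (f ∘ inj₁)
  HasUniqueColour-⊎ˡ {S} f ¬S₂ = mk⇔ restrict extend
    where
    restrict : HasUniqueColour S f → HasUniqueColour (S ∘ inj₁) (f ∘ inj₁)
    restrict (c , inj₁ u , Su , fu , unique) =
      c , u , Su , fu , λ w Sw fw → inj₁-injective (unique (inj₁ w) Sw fw)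
    restrict (c , inj₂ u , Su , _) with () ← ¬S₂ u Su
    extend : HasUniqueColour (S ∘ inj₁) (f ∘ inj₁) → HasUniqueColour S f
    extend (c , u , Su , fu , unique) = c , inj₁ u , Su , fu , unique′
      where
      unique′ : ∀ w → S w → f w ≡ just c → w ≡ inj₁ u
      unique′ (inj₁ w) Sw fw = cong inj₁ (unique w Sw fw)
      unique′ (inj₂ w) Sw _ with () ← ¬S₂ w Sw

  HasUniqueColour-⊎ʳ : {S : A ⊎ B → Set} (f : A ⊎ B → Maybe ℕ) → (∀ a → ¬ S (inj₁ a)) →
    HasUniqueColour S f ⇔ HasUniqueColour (S ∘ inj₂) (f ∘ inj₂)
  HasUniqueColour-⊎ʳ {S} f ¬S₁ = mk⇔ restrict extend
    where
    restrict : HasUniqueColour S f → HasUniqueColour (S ∘ inj₂) (f ∘ inj₂)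
    restrict (c , inj₂ u , Su , fu , unique) =
      c , u , Su , fu , λ w Sw fw → inj₂-injective (unique (inj₂ w) Sw fw)
    restrict (c , inj₁ u , Su , _) with () ← ¬S₁ u Su
    extend : HasUniqueColour (S ∘ inj₂) (f ∘ inj₂) → HasUniqueColour S f
    extend (c , u , Su , fu , unique) = c , inj₂ u , Su , fu , unique′
      where
      unique′ : ∀ w → S w → f w ≡ just c → w ≡ inj₂ u
      unique′ (inj₂ w) Sw fw = cong inj₂ (unique w Sw fw)
      unique′ (inj₁ w) Sw _ with () ← ¬S₁ w Sw

module _ {n : ℕ} (G : Graph (Fin n)) where

  private
    D : Graph (Fin n ⊎ Fin n)
    D = ExtDoubleCover G

  uniqueAtX⇔ : (F : Fin n ⊎ Fin n → Maybe ℕ) (i : Fin n) →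
    HasUniqueColour N[ D ]⟨ inj₁ i ⟩ F ⇔ HasUniqueColour N[ G ]⟦ i ⟧ (F ∘ inj₂)
  uniqueAtX⇔ F i = HasUniqueColour-⊎ʳ F λ _ ()

  uniqueAtY⇔ : (F : Fin n ⊎ Fin n → Maybe ℕ) (j : Fin n) →
    HasUniqueColour N[ D ]⟨ inj₂ j ⟩ F ⇔ HasUniqueColour N[ G ]⟦ j ⟧ (F ∘ inj₁)
  uniqueAtY⇔ F j = ⇔.trans (HasUniqueColour-⊎ˡ F λ _ ())
    (HasUniqueColour-resp (F ∘ inj₁) λ i → mk⇔ (∈closedNbhd-sym G) (∈closedNbhd-sym G))

  onX : ∀ {k} → ListAssignment k (Fin n ⊎ Fin n) → ListAssignment k (Fin n)
  onX (L , p) = L ∘ inj₁ , p ∘ inj₁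

  onY : ∀ {k} → ListAssignment k (Fin n ⊎ Fin n) → ListAssignment k (Fin n)
  onY (L , p) = L ∘ inj₂ , p ∘ inj₂

  onBothSides : ∀ {k} → ListAssignment k (Fin n) → ListAssignment k (Fin n ⊎ Fin n)
  onBothSides (L , p) = [ L , L ] , [ p , p ]

  CFONStar-join : ∀ {k} (L : ListAssignment k (Fin n ⊎ Fin n)) {g h : Fin n → Maybe ℕ} →
    IsCFCNStarColouring G (onX L) g → IsCFCNStarColouring G (onY L) h →
    IsCFONStarColouring D L [ g , h ]
  CFONStar-join L (g∈L , g-cf) (h∈L , h-cf) = [ g∈L , h∈L ] , λ where
    (inj₁ i) → from (uniqueAtX⇔ _ i) (h-cf i)
    (inj₂ j) → from (uniqueAtY⇔ _ j) (g-cf j)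

  CFON-join : ∀ {k} (L : ListAssignment k (Fin n ⊎ Fin n)) {g h : Fin n → ℕ} →
    IsCFCNColouring G (onX L) g → IsCFCNColouring G (onY L) h →
    IsCFONColouring D L [ g , h ]
  CFON-join L (g∈L , g-cf) (h∈L , h-cf) = [ g∈L , h∈L ] , λ where
    (inj₁ i) → from (uniqueAtX⇔ _ i) (h-cf i)
    (inj₂ j) → from (uniqueAtY⇔ _ j) (g-cf j)

  CFCNStar-onX : ∀ {k} (L : ListAssignment k (Fin n)) {F : Fin n ⊎ Fin n → Maybe ℕ} →
    IsCFONStarColouring D (onBothSides L) F → IsCFCNStarColouring G L (F ∘ inj₁)
  CFCNStar-onX L (F∈L , F-cf) = F∈L ∘ inj₁ , λ j → to (uniqueAtY⇔ _ j) (F-cf (inj₂ j))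

  CFCN-onX : ∀ {k} (L : ListAssignment k (Fin n)) {F : Fin n ⊎ Fin n → ℕ} →
    IsCFONColouring D (onBothSides L) F → IsCFCNColouring G L (F ∘ inj₁)
  CFCN-onX L (F∈L , F-cf) = F∈L ∘ inj₁ , λ j → to (uniqueAtY⇔ _ j) (F-cf (inj₂ j))

  CFCNStarChoosable⇔ : ∀ {k} → CFCNStarChoosable k G ⇔ CFONStarChoosable k D
  CFCNStarChoosable⇔ {k} = mk⇔ join restrict
    where
    join : CFCNStarChoosable k G → CFONStarChoosable k D
    join choose L with (g , g-ok) ← choose (onX L) | (h , h-ok) ← choose (onY L) =
      [ g , h ] , CFONStar-join L g-ok h-ok
    restrict : CFONStarChoosable k D → CFCNStarChoosable k G
    restrict choose L with (F , F-ok) ← choose (onBothSides L) = F ∘ inj₁ , CFCNStar-onX L F-ok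

  CFCNChoosable⇔ : ∀ {k} → CFCNChoosable k G ⇔ CFONChoosable k D
  CFCNChoosable⇔ {k} = mk⇔ join restrict
    where
    join : CFCNChoosable k G → CFONChoosable k D
    join choose L with (g , g-ok) ← choose (onX L) | (h , h-ok) ← choose (onY L) =
      [ g , h ] , CFON-join L g-ok h-ok
    restrict : CFONChoosable k D → CFCNChoosable k G
    restrict choose L with (F , F-ok) ← choose (onBothSides L) = F ∘ inj₁ , CFCN-onX L F-ok

lemma6 : ∀ (n : ℕ) (G : Graph (Fin n)) (k : ℕ) → k ≥ 1 →
    (CFCNStarChoosable k G ⇔ CFONStarChoosable k (ExtDoubleCover G))
    × (CFCNChoosable k G ⇔ CFONChoosable k (ExtDoubleCover G))
lemma6 n G k _ = CFCNStarChoosable⇔ G , CFCNChoosable⇔ G
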